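{- Let $t$ be a closed term and let $\Phi$ be a derivation in the CbV type system of $\vdash^{(m,e)} t : M$ (empty type context). Then there exists $s$ and an evaluation sequence $d \colon t \to_{\mathrm{need}}^{*} s$ with $\mathrm{normal}(s)$, $|d|_m \leq m$ and $|d|_e\leq e$.
   Context: Terms: $t,s ::= x \mid \lambda x.t \mid t\,s \mid t[x\leftarrow s]$, where $t[x\leftarrow s]$ (explicit substitution) binds $x$ in $t$; values $v ::= \lambda x.t$. $\mathrm{fv}(t[x\leftarrow s])=(\mathrm{fv}(t)\setminus\{x\})\cup\mathrm{fv}(s)$; closed means no free variables; terms up to $\alpha$-equivalence. Contexts (one hole $\langle\cdot\rangle$): substitution contexts $S ::= \langle\cdot\rangle \mid S[x\leftarrow t]$; CbNeed contexts $E ::= \langle\cdot\rangle \mid E\,t \mid E[x\leftarrow t] \mid E\langle\langle x\rangle\rangle[x\leftarrow E']$. $E\langle t\rangle$ is plugging (may capture); $E\langle\langle t\rangle\rangle$ is plugging where $E$ does not capture free variables of $t$. Root steps: $S\langle\lambda x.t\rangle s \mapsto_m S\langle t[x\leftarrow s]\rangle$ (variables bound by $S$ disjoint from $\mathrm{fv}(s)$); $E\langle\langle x\rangle\rangle[x\leftarrow S\langle v\rangle] \mapsto_{e} S\langle E\langle\langle v\rangle\rangle[x\leftarrow v]\rangle$ (variables bound by $S$ disjoint from $\mathrm{fv}(E\langle\langle x\rangle\rangle)$). $\to_{m,\mathrm{need}}$ (resp. $\to_{e,\mathrm{need}}$) relates $E\langle t'\rangle$ to $E\langle s'\rangle$ for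 any CbNeed context $E$ whenever $t'\mapsto_m s'$ (resp. $t'\mapsto_e s'$); $\to_{\mathrm{need}}$ is their union. $|d|_m$, $|d|_e$ count multiplicative and exponential steps of $d$. $\mathrm{normal}$ is the least predicate with $\mathrm{normal}(\lambda x.t)$ and $\mathrm{normal}(t)\Rightarrow\mathrm{normal}(t[x\leftarrow s])$. CbV types: linear types $L ::= M\to N$; multi types $M,N ::= [L_i]_{i\in J}$ finite multisets, $\mathbf 0$ empty multiset, $\uplus$ union. Type contexts $\Gamma$ map variables to multi types, all but finitely many to $\mathbf 0$; $\uplus$ pointwise; $\Gamma,x:M$ means $\Gamma\uplus(x\mapsto M)$ with $\Gamma(x)=\mathbf 0$. Rules: (ax) $x:M\vdash^{(0,1)} x:M$ for any multi type $M$; (app) from $\Gamma\vdash^{(m,e)} t:[M\to N]$ and $\Pi\vdash^{(m',e')} s:M$ infer $\Gamma\uplus\Pi\vdash^{(m+m'+1,e+e')} t\,s:N$; (fun) from $\Gamma,x:N\vdash^{(m,e)} t:M$ infer $\Gamma\vdash^{(m,e)}\lambda x.t:N\to M$; (many) from $\Pi_i\vdash^{(m_i,e_i)}\lambda x.t:L_i$ for $i\in J$ ($J$ finite, possibly empty) infer $\biguplus_i\Pi_i\vdash^{(\sum m_i,\sum e_i)}\lambda x.t:[L_i]_{i\in J}$; (ES) from $\Gamma,x:N\vdash^{(m,e)} t:M$ and $\Pi\vdash^{(m',e')} s:N$ infer $\Gamma\uplus\Pi\vdash^{(m+m',e+e')} t[x\leftarrow s]:M$. -}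

module Defs where

open import Data.Nat using (ℕ; zero; suc; _+_)
open import Data.Fin using (Fin; zero; suc)
open import Data.List using (List; []; _∷_)
import Data.List as List
open import Data.Vec using (Vec; []; _∷_; replicate; zipWith; _[_]≔_)

-- Tm n = terms whose free variables are among n variables.
--   var x, lam t (binds var 0 in t), app t s,
--   es t s  =  t[x←s]  (binds var 0 in t, s in outer scope)

data Tm (n : ℕ) : Set where
  var : Fin n → Tm n
  lam : Tm (suc n) → Tm n
  app : Tm n → Tm n → Tm n
  es  : Tm (suc n) → Tm n → Tm n

Ren : ℕ → ℕ → Set
Ren n n' = Fin n → Fin n'

lift : ∀ {n n'} → Ren n n' → Ren (suc n) (suc n')
lift ρ zero    = zero
lift ρ (suc x) = suc (ρ x)

ren : ∀ {n n'} → Ren n n' → Tm n → Tm n'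
ren ρ (var x)  = var (ρ x)
ren ρ (lam t)  = lam (ren (lift ρ) t)
ren ρ (app t s) = app (ren ρ t) (ren ρ s)
ren ρ (es t s) = es (ren (lift ρ) t) (ren ρ s)

-- b ⊕ n : scope obtained from n by going under b binders
_⊕_ : ℕ → ℕ → ℕ
zero  ⊕ n = n
suc b ⊕ n = b ⊕ suc n

wk : ∀ {n} (b : ℕ) → Ren n (b ⊕ n)
wk zero    x = x
wk (suc b) x = wk b (suc x)

-- Substitution contexts  S ::= ⟨·⟩ | S[x←t]
-- SCtx n b : outer scope n, b binders above the hole (hole scope b ⊕ n)

data SCtx : ℕ → ℕ → Set where
  sHole : ∀ {n} → SCtx n 0
  sES   : ∀ {n b} → SCtx (suc n) b → Tm n → SCtx n (suc b)

plugS : ∀ {n b} → SCtx n b → Tm (b ⊕ n) → Tm n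
plugS sHole     u = u
plugS (sES S t) u = es (plugS S u) t

-- CbNeed contexts  E ::= ⟨·⟩ | E t | E[x←t] | E⟨⟨x⟩⟩[x←E']
-- Ctx n b : outer scope n, b binders above the hole (hole scope b ⊕ n)

data Ctx : ℕ → ℕ → Set where
  hole : ∀ {n} → Ctx n 0
  appL : ∀ {n b} → Ctx n b → Tm n → Ctx n b
  esL  : ∀ {n b} → Ctx (suc n) b → Tm n → Ctx n (suc b)
  -- esR E E'  represents  E⟨⟨x⟩⟩[x←E']  (x = bound variable 0)
  esR  : ∀ {n b b'} → Ctx (suc n) b → Ctx n b' → Ctx n b'

mutual
  -- plugging  E⟨u⟩  (may capture)
  plug : ∀ {n b} → Ctx n b → Tm (b ⊕ n) → Tm n
  plug hole        u = u
  plug (appL E t)  u = app (plug E u) t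
  plug (esL E t)   u = es (plug E u) t
  plug (esR E E')  u = es (plugNC E (var zero)) (plug E' u)

  -- capture-avoiding plugging  E⟨⟨u⟩⟩  (u in the outer scope of E)
  plugNC : ∀ {n b} → Ctx n b → Tm n → Tm n
  plugNC {b = b} E u = plug E (ren (wk b) u)

renC : ∀ {n n' b} → Ren n n' → Ctx n b → Ctx n' b
renC ρ hole       = hole
renC ρ (appL E t) = appL (renC ρ E) (ren ρ t)
renC ρ (esL E t)  = esL (renC (lift ρ) E) (ren ρ t)
renC ρ (esR E E') = esR (renC (lift ρ) E) (renC ρ E')

-- S⟨λx.t⟩ s ↦m S⟨t[x←s]⟩
data _↦m_ {n : ℕ} : Tm n → Tm n → Set where
  rootM : ∀ {b} (S : SCtx n b) (t : Tm (suc (b ⊕ n))) (s : Tm n) →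
          app (plugS S (lam t)) s ↦m plugS S (es t (ren (wk b) s))

-- E⟨⟨x⟩⟩[x←S⟨v⟩] ↦e S⟨E⟨⟨v⟩⟩[x←v]⟩ ,  v = λy.t
data _↦e_ {n : ℕ} : Tm n → Tm n → Set where
  rootE : ∀ {bE bS} (E : Ctx (suc n) bE) (S : SCtx n bS) (t : Tm (suc (bS ⊕ n))) →
          es (plugNC E (var zero)) (plugS S (lam t)) ↦e
          plugS S (es (plugNC (renC (lift (wk bS)) E) (ren suc (lam t))) (lam t))

data _⟶m_ {n : ℕ} : Tm n → Tm n → Set where
  ctxM : ∀ {b} (E : Ctx n b) {t s : Tm (b ⊕ n)} → t ↦m s → plug E t ⟶m plug E s

data _⟶e_ {n : ℕ} : Tm n → Tm n → Set where
  ctxE : ∀ {b} (E : Ctx n b) {t s : Tm (b ⊕ n)} → t ↦e s → plug E t ⟶e plug E s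

data _⟶*_ {n : ℕ} : Tm n → Tm n → Set where
  done  : ∀ {t} → t ⟶* t
  stepM : ∀ {t u s} → t ⟶m u → u ⟶* s → t ⟶* s
  stepE : ∀ {t u s} → t ⟶e u → u ⟶* s → t ⟶* s

lenM : ∀ {n} {t s : Tm n} → t ⟶* s → ℕ
lenM done        = 0
lenM (stepM _ d) = suc (lenM d)
lenM (stepE _ d) = lenM d

lenE : ∀ {n} {t s : Tm n} → t ⟶* s → ℕ
lenE done        = 0
lenE (stepM _ d) = lenE d
lenE (stepE _ d) = suc (lenE d)

data Normal {n : ℕ} : Tm n → Set where
  nLam : ∀ {t} → Normal (lam t)
  nES  : ∀ {t s} → Normal t → Normal (es t s)

-- CbV multi types. Multisets are represented by lists, identified up to
-- (deep) permutation via _≈M_.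

data LTy : Set where
  _⇒_ : List LTy → List LTy → LTy

MTy : Set
MTy = List LTy

mutual
  data _≈L_ : LTy → LTy → Set where
    arrEq : ∀ {M M' N N'} → M ≈M M' → N ≈M N' → (M ⇒ N) ≈L (M' ⇒ N')

  data _≈M_ : MTy → MTy → Set where
    nilEq  : [] ≈M []
    consEq : ∀ {L L' M M'} → L ≈L L' → M ≈M M' → (L ∷ M) ≈M (L' ∷ M')
    swapEq : ∀ {L L' M} → (L ∷ L' ∷ M) ≈M (L' ∷ L ∷ M)
    transEq : ∀ {M M' M''} → M ≈M M' → M' ≈M M'' → M ≈M M''

TCtx : ℕ → Set
TCtx n = Vec MTy n

emptyT : ∀ {n} → TCtx n
emptyT = replicate _ []

_⊎T_ : ∀ {n} → TCtx n → TCtx n → TCtx n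
_⊎T_ = zipWith List._++_

single : ∀ {n} → Fin n → MTy → TCtx n
single x M = emptyT [ x ]≔ M

mutual
  data Der {n : ℕ} : TCtx n → Tm n → MTy → ℕ → ℕ → Set where
    ax   : ∀ (x : Fin n) (M : MTy) → Der (single x M) (var x) M 0 1
    app  : ∀ {Γ Π t s M M' N m e m' e'} →
           Der Γ t ((M ⇒ N) ∷ []) m e → Der Π s M' m' e' → M ≈M M' →
           Der (Γ ⊎T Π) (app t s) N (m + m' + 1) (e + e')
    many : ∀ {Γ t M m e} → Many Γ t M m e → Der Γ (lam t) M m e
    esT  : ∀ {Γ Π t s M N N' m e m' e'} →
           Der (N ∷ Γ) t M m e → Der Π s N' m' e' → N ≈M N' →
           Der (Γ ⊎T Π) (es t s) M (m + m') (e + e')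

  data DerL {n : ℕ} : TCtx n → Tm (suc n) → LTy → ℕ → ℕ → Set where
    fun : ∀ {Γ t N M m e} → Der (N ∷ Γ) t M m e → DerL Γ t (N ⇒ M) m e

  data Many {n : ℕ} : TCtx n → Tm (suc n) → MTy → ℕ → ℕ → Set where
    manyNil  : ∀ {t} → Many emptyT t [] 0 0
    manyCons : ∀ {Γ Δ t L M m e m' e'} →
               DerL Γ t L m e → Many Δ t M m' e' →
               Many (Γ ⊎T Δ) t (L ∷ M) (m + m') (e + e')

-- The proof is quantitative subject reduction plus progress.
--  * Typing is relaxed to Der≈, where multisets and type contexts are read up
--    to permutation; type contexts form a commutative monoid (pointwise lift
--    of multisets under _++_), which handles all context bookkeeping.
--  * For Der≈ we prove inversion, permutation and splitting of the premises
--    of rule many, and stability under renaming.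
--  * Derivations factor along substitution contexts and CbNeed contexts
--    (SFactor, EFactor); this lifts root steps to steps under contexts and
--    locates the typed occurrence of the variable substituted by an e-step.
--  * An m-step lowers m by exactly one and an e-step lowers e by exactly one.
--  * Every term is normal, reduces, or is stuck on a free variable, so a
--    closed term is normal or reduces; lexicographic induction on (m, e)
--    then builds the evaluation sequence.
module Submission where

open import Defs
open import Level using (0ℓ)
open import Data.Nat using (ℕ; zero; suc; _+_; _≤_; z≤n; s≤s)
open import Data.Nat.Properties using (+-assoc; +-comm; +-identityʳ; +-commutativeSemigroup)
open import Data.Fin using (Fin; zero; suc)
open import Data.List using ([]; _∷_; _++_)
open import Data.List.Properties using (++-assoc; ++-identityʳ)
open import Data.Vec using ([]; _∷_)
open import Data.Vec.Relation.Binary.Pointwise.Inductive as Pointwise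
  using (Pointwise; []; _∷_)
open import Data.Product using (Σ; _×_; _,_)
open import Function using (id; _∘_)
open import Algebra.Bundles using (CommutativeMonoid)
open import Algebra.Structures using (IsCommutativeMonoid)
import Algebra.Properties.CommutativeSemigroup as CommSemigroupProperties
open import Relation.Binary.Structures using (IsEquivalence)
open import Relation.Binary.PropositionalEquality
  using (_≡_; refl; sym; trans; cong; cong₂; subst; subst₂)

mutual
  ≈L-refl : ∀ L → L ≈L L
  ≈L-refl (M ⇒ N) = arrEq (≈M-refl M) (≈M-refl N)

  ≈M-refl : ∀ M → M ≈M M
  ≈M-refl []      = nilEq
  ≈M-refl (L ∷ M) = consEq (≈L-refl L) (≈M-refl M)

mutual
  ≈L-sym : ∀ {L L'} → L ≈L L' → L' ≈L L
  ≈L-sym (arrEq p q) = arrEq (≈M-sym p) (≈M-sym q)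

  ≈M-sym : ∀ {M M'} → M ≈M M' → M' ≈M M
  ≈M-sym nilEq         = nilEq
  ≈M-sym (consEq p q)  = consEq (≈L-sym p) (≈M-sym q)
  ≈M-sym swapEq        = swapEq
  ≈M-sym (transEq p q) = transEq (≈M-sym q) (≈M-sym p)

≈M-reflexive : ∀ {M M'} → M ≡ M' → M ≈M M'
≈M-reflexive {M} refl = ≈M-refl M

≈M-isEquivalence : IsEquivalence _≈M_
≈M-isEquivalence = record
  { refl = ≈M-refl _ ; sym = ≈M-sym ; trans = transEq }

++-congˡ : ∀ {M M'} N → M ≈M M' → (M ++ N) ≈M (M' ++ N)
++-congˡ N nilEq         = ≈M-refl N
++-congˡ N (consEq p q)  = consEq p (++-congˡ N q)
++-congˡ N swapEq        = swapEq
++-congˡ N (transEq p q) = transEq (++-congˡ N p) (++-congˡ N q)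

++-congʳ : ∀ M {N N'} → N ≈M N' → (M ++ N) ≈M (M ++ N')
++-congʳ []      q = q
++-congʳ (L ∷ M) q = consEq (≈L-refl L) (++-congʳ M q)

++-middle : ∀ M L N → (M ++ (L ∷ N)) ≈M (L ∷ (M ++ N))
++-middle []      L N = ≈M-refl (L ∷ N)
++-middle (K ∷ M) L N = transEq (consEq (≈L-refl K) (++-middle M L N)) swapEq

++-commM : ∀ M N → (M ++ N) ≈M (N ++ M)
++-commM []      N = ≈M-reflexive (sym (++-identityʳ N))
++-commM (L ∷ M) N =
  transEq (consEq (≈L-refl L) (++-commM M N)) (≈M-sym (++-middle N L M))

multiset-isCommutativeMonoid : IsCommutativeMonoid _≈M_ _++_ []
multiset-isCommutativeMonoid = record
  { isMonoid = record
    { isSemigroup = record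
      { isMagma = record
        { isEquivalence = ≈M-isEquivalence
        ; ∙-cong = λ {M} {M'} {N} {N'} p q → transEq (++-congˡ N p) (++-congʳ M' q)
        }
      ; assoc = λ M N K → ≈M-reflexive (++-assoc M N K)
      }
    ; identity = ≈M-refl , λ M → ≈M-reflexive (++-identityʳ M)
    }
  ; comm = ++-commM
  }

infix 4 _≈C_
_≈C_ : ∀ {n} → TCtx n → TCtx n → Set
_≈C_ = Pointwise _≈M_

ctx-commutativeMonoid : ℕ → CommutativeMonoid 0ℓ 0ℓ
ctx-commutativeMonoid n = record
  { Carrier = TCtx n ; _≈_ = _≈C_ ; _∙_ = _⊎T_ ; ε = emptyT
  ; isCommutativeMonoid = record
    { isMonoid = record
      { isSemigroup = record
        { isMagma = record
          { isEquivalence = Pointwise.isEquivalence ≈M-isEquivalence n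
          ; ∙-cong = Pointwise.zipWith-cong M.∙-cong
          }
        ; assoc = Pointwise.zipWith-assoc M.assoc
        }
      ; identity = Pointwise.zipWith-identityˡ M.identityˡ
                 , Pointwise.zipWith-identityʳ M.identityʳ
      }
    ; comm = Pointwise.zipWith-comm M.comm
    }
  }
  where module M = IsCommutativeMonoid multiset-isCommutativeMonoid

module TC {n : ℕ} where
  open CommutativeMonoid (ctx-commutativeMonoid n) public
    using (refl; sym; trans; reflexive; ∙-cong; comm; assoc; identityˡ; identityʳ)
  open CommSemigroupProperties (CommutativeMonoid.commutativeSemigroup (ctx-commutativeMonoid n)) public
    using (interchange; xy∙z≈xz∙y; xy∙z≈x∙zy; x∙yz≈y∙xz)

module ℕₚ = CommSemigroupProperties +-commutativeSemigroup

single-empty : ∀ {n} (x : Fin n) → single x [] ≡ emptyT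
single-empty zero    = refl
single-empty (suc x) = cong ([] ∷_) (single-empty x)

single-++ : ∀ {n} (x : Fin n) M N → single x (M ++ N) ≈C single x M ⊎T single x N
single-++ zero    M N = ≈M-refl (M ++ N) ∷ TC.sym (TC.identityˡ emptyT)
single-++ (suc x) M N = nilEq ∷ single-++ x M N

single-cong : ∀ {n} (x : Fin n) {M N} → M ≈M N → single x M ≈C single x N
single-cong zero    p = p ∷ TC.refl
single-cong (suc x) p = nilEq ∷ single-cong x p

-- push ρ Γ is the type context of ren ρ t when Γ is that of t: the
-- multi type of every variable x is moved to ρ x (and merged there).
-- It is a monoid morphism sending singletons to singletons.

push : ∀ {n n'} → Ren n n' → TCtx n → TCtx n'
push ρ []      = emptyT
push ρ (M ∷ Γ) = single (ρ zero) M ⊎T push (ρ ∘ suc) Γ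

push-cong : ∀ {n n'} (ρ : Ren n n') {Γ Γ' : TCtx n} → Γ ≈C Γ' → push ρ Γ ≈C push ρ Γ'
push-cong ρ []       = TC.refl
push-cong ρ (p ∷ ps) = TC.∙-cong (single-cong (ρ zero) p) (push-cong (ρ ∘ suc) ps)

push-nil : ∀ {n n'} (ρ : Ren (suc n) n') (Γ : TCtx n) → push ρ ([] ∷ Γ) ≈C push (ρ ∘ suc) Γ
push-nil ρ Γ rewrite single-empty (ρ zero) = TC.identityˡ _

push-empty : ∀ {n n'} (ρ : Ren n n') → push ρ emptyT ≈C emptyT
push-empty {zero}  ρ = TC.refl
push-empty {suc n} ρ = TC.trans (push-nil ρ emptyT) (push-empty (ρ ∘ suc))

push-⊎ : ∀ {n n'} (ρ : Ren n n') (Γ Δ : TCtx n) → push ρ (Γ ⊎T Δ) ≈C push ρ Γ ⊎T push ρ Δ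
push-⊎ ρ []      []      = TC.sym (TC.identityˡ emptyT)
push-⊎ ρ (M ∷ Γ) (N ∷ Δ) =
  TC.trans (TC.∙-cong (single-++ (ρ zero) M N) (push-⊎ (ρ ∘ suc) Γ Δ))
           (TC.interchange _ _ _ _)

push-single : ∀ {n n'} (ρ : Ren n n') (x : Fin n) M → push ρ (single x M) ≈C single (ρ x) M
push-single ρ zero    M = TC.trans (TC.∙-cong TC.refl (push-empty (ρ ∘ suc))) (TC.identityʳ _)
push-single ρ (suc x) M = TC.trans (push-nil ρ (single x M)) (push-single (ρ ∘ suc) x M)

push-suc : ∀ {n n'} (ρ : Ren n n') (Γ : TCtx n) → push (λ x → suc (ρ x)) Γ ≡ [] ∷ push ρ Γ
push-suc ρ []      = refl
push-suc ρ (M ∷ Γ) rewrite push-suc (ρ ∘ suc) Γ = refl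

push-lift : ∀ {n n'} (ρ : Ren n n') N (Γ : TCtx n) → push (lift ρ) (N ∷ Γ) ≈C N ∷ push ρ Γ
push-lift ρ N Γ rewrite push-suc ρ Γ = ≈M-reflexive (++-identityʳ N) ∷ TC.identityˡ _

push-id : ∀ {n} (Γ : TCtx n) → push id Γ ≈C Γ
push-id []      = []
push-id (M ∷ Γ) = TC.trans (push-lift id M Γ) (≈M-refl M ∷ push-id Γ)

push-weaken : ∀ {n} (Γ : TCtx n) → push suc Γ ≈C [] ∷ Γ
push-weaken Γ = TC.trans (TC.reflexive (push-suc id Γ)) (nilEq ∷ push-id Γ)

-- Every Der embeds,
-- and subject reduction is proved for this more flexible system.

mutual
  data Der≈ {n : ℕ} : TCtx n → Tm n → MTy → ℕ → ℕ → Set where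
    ax≈   : (x : Fin n) (M : MTy) → Der≈ (single x M) (var x) M 0 1
    app≈  : ∀ {Γ Π t s A B m e m' e'} →
            Der≈ Γ t ((A ⇒ B) ∷ []) m e → Der≈ Π s A m' e' →
            Der≈ (Γ ⊎T Π) (app t s) B (m + m' + 1) (e + e')
    lam≈  : ∀ {Γ t M m e} → Many≈ Γ t M m e → Der≈ Γ (lam t) M m e
    es≈   : ∀ {Γ Π t s M N m e m' e'} →
            Der≈ (N ∷ Γ) t M m e → Der≈ Π s N m' e' →
            Der≈ (Γ ⊎T Π) (es t s) M (m + m') (e + e')
    conv  : ∀ {Γ Γ' t M M' m e} → Der≈ Γ t M m e → Γ ≈C Γ' → M ≈M M' → Der≈ Γ' t M' m e

  -- the premises of rule many, each already an instance of rule fun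
  data Many≈ {n : ℕ} : TCtx n → Tm (suc n) → MTy → ℕ → ℕ → Set where
    nil≈  : ∀ {t} → Many≈ emptyT t [] 0 0
    cons≈ : ∀ {Γ Δ t N M K m e m' e'} →
            Der≈ (N ∷ Γ) t M m e → Many≈ Δ t K m' e' →
            Many≈ (Γ ⊎T Δ) t ((N ⇒ M) ∷ K) (m + m') (e + e')

mutual
  embed : ∀ {n} {Γ : TCtx n} {t M m e} → Der Γ t M m e → Der≈ Γ t M m e
  embed (ax x M)      = ax≈ x M
  embed (app d₁ d₂ p) = app≈ (embed d₁) (conv (embed d₂) TC.refl (≈M-sym p))
  embed (many ds)     = lam≈ (embed-many ds)
  embed (esT d₁ d₂ p) = es≈ (embed d₁) (conv (embed d₂) TC.refl (≈M-sym p))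

  embed-many : ∀ {n} {Γ : TCtx n} {t M m e} → Many Γ t M m e → Many≈ Γ t M m e
  embed-many manyNil               = nil≈
  embed-many (manyCons (fun d) ds) = cons≈ (embed d) (embed-many ds)

cast : ∀ {n} {Γ : TCtx n} {t M m e m' e'} → m ≡ m' → e ≡ e' → Der≈ Γ t M m e → Der≈ Γ t M m' e'
cast refl refl d = d

cast-+0 : ∀ {n} {Γ : TCtx n} {t M m e} → Der≈ Γ t M m e → Der≈ Γ t M (m + 0) (e + 0)
cast-+0 {m = m} {e} = cast (sym (+-identityʳ m)) (sym (+-identityʳ e))

conv-ctx : ∀ {n} {Γ Γ' : TCtx n} {t M m e} → Γ ≈C Γ' → Der≈ Γ t M m e → Der≈ Γ' t M m e
conv-ctx c d = conv d c (≈M-refl _)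

record Split {n : ℕ} (Γ : TCtx n) (m e : ℕ) (P Q : TCtx n → ℕ → ℕ → Set) : Set where
  constructor split
  field
    {Γ₁ Γ₂}       : TCtx n
    {m₁ e₁ m₂ e₂} : ℕ
    left          : P Γ₁ m₁ e₁
    right         : Q Γ₂ m₂ e₂
    ctx-eq        : Γ ≈C Γ₁ ⊎T Γ₂
    m-eq          : m ≡ m₁ + m₂
    e-eq          : e ≡ e₁ + e₂

many-perm : ∀ {n} {Γ : TCtx n} {t M M' m e} → Many≈ Γ t M m e → M ≈M M' →
            Σ (TCtx n) λ Γ' → Γ ≈C Γ' × Many≈ Γ' t M' m e
many-perm nil≈ nilEq = _ , TC.refl , nil≈
many-perm (cons≈ d ds) (consEq (arrEq p q) r) with many-perm ds r
... | _ , c , ds' = _ , TC.∙-cong TC.refl c , cons≈ (conv d (p ∷ TC.refl) q) ds'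
many-perm (cons≈ {Γ = Γ₁} {m = m₁} {e = e₁} d₁
            (cons≈ {Γ = Γ₂} {Δ = Γ₃} {m = m₂} {e = e₂} {m' = m₃} {e' = e₃} d₂ ds)) swapEq =
  _ , TC.x∙yz≈y∙xz Γ₁ Γ₂ Γ₃ ,
  subst₂ (Many≈ _ _ _) (ℕₚ.x∙yz≈y∙xz m₂ m₁ m₃) (ℕₚ.x∙yz≈y∙xz e₂ e₁ e₃) (cons≈ d₂ (cons≈ d₁ ds))
many-perm ds (transEq p q) with many-perm ds p
... | _ , c , ds' with many-perm ds' q
...   | _ , c' , ds'' = _ , TC.trans c c' , ds''

many-split : ∀ {n} {Γ : TCtx n} {t} A B {m e} → Many≈ Γ t (A ++ B) m e →
             Split Γ m e (λ Γ₁ → Many≈ Γ₁ t A) (λ Γ₂ → Many≈ Γ₂ t B)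
many-split []      B ds = split nil≈ ds (TC.sym (TC.identityˡ _)) refl refl
many-split (L ∷ A) B (cons≈ {Γ = Γ₀} {m = m₀} {e = e₀} d ds) with many-split A B ds
... | split {Γ₁} {Γ₂} {m₁} {e₁} {m₂} {e₂} dsA dsB c refl refl =
  split (cons≈ d dsA) dsB (TC.trans (TC.∙-cong TC.refl c) (TC.sym (TC.assoc Γ₀ Γ₁ Γ₂)))
        (sym (+-assoc m₀ m₁ m₂)) (sym (+-assoc e₀ e₁ e₂))

inv-var : ∀ {n} {Γ : TCtx n} {x M m e} → Der≈ Γ (var x) M m e →
          Γ ≈C single x M × m ≡ 0 × e ≡ 1
inv-var (ax≈ x M) = TC.refl , refl , refl
inv-var (conv d p q) with inv-var d
... | c , refl , refl = TC.trans (TC.sym p) (TC.trans c (single-cong _ q)) , refl , refl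

inv-app : ∀ {n} {Γ : TCtx n} {t s B m e} → Der≈ Γ (app t s) B m e →
          Σ MTy λ A → Σ ℕ λ m₀ → m ≡ m₀ + 1 ×
          Split Γ m₀ e (λ Γ₁ → Der≈ Γ₁ t ((A ⇒ B) ∷ [])) (λ Γ₂ → Der≈ Γ₂ s A)
inv-app (app≈ d₁ d₂) = _ , _ , refl , split d₁ d₂ TC.refl refl refl
inv-app (conv d p q) with inv-app d
... | A , m₀ , m-eq , split d₁ d₂ c m₀-eq e-eq =
  A , m₀ , m-eq ,
  split (conv d₁ TC.refl (consEq (arrEq (≈M-refl A) q) nilEq)) d₂ (TC.trans (TC.sym p) c) m₀-eq e-eq

inv-es : ∀ {n} {Γ : TCtx n} {t s M m e} → Der≈ Γ (es t s) M m e →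
         Σ MTy λ N → Split Γ m e (λ Γ₁ → Der≈ (N ∷ Γ₁) t M) (λ Γ₂ → Der≈ Γ₂ s N)
inv-es (es≈ d₁ d₂) = _ , split d₁ d₂ TC.refl refl refl
inv-es (conv d p q) with inv-es d
... | N , split d₁ d₂ c m-eq e-eq =
  N , split (conv d₁ TC.refl q) d₂ (TC.trans (TC.sym p) c) m-eq e-eq

inv-lam : ∀ {n} {Γ : TCtx n} {t M m e} → Der≈ Γ (lam t) M m e →
          Σ (TCtx n) λ Γ' → Γ ≈C Γ' × Many≈ Γ' t M m e
inv-lam (lam≈ ds) = _ , TC.refl , ds
inv-lam (conv d p q) with inv-lam d
... | _ , c , ds with many-perm ds q
...   | _ , c' , ds' = _ , TC.trans (TC.sym p) (TC.trans c c') , ds'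

inv-fun : ∀ {n} {Γ : TCtx n} {t A B m e} → Der≈ Γ (lam t) ((A ⇒ B) ∷ []) m e →
          Der≈ (A ∷ Γ) t B m e
inv-fun d with inv-lam d
... | _ , c , cons≈ {Γ = Γ₀} d₀ nil≈ =
  cast-+0 (conv-ctx (≈M-refl _ ∷ TC.sym (TC.trans c (TC.identityʳ Γ₀))) d₀)

mutual
  ren-der : ∀ {n n'} (ρ : Ren n n') {Γ t M m e} → Der≈ Γ t M m e →
            Der≈ (push ρ Γ) (ren ρ t) M m e
  ren-der ρ (ax≈ x M) = conv-ctx (TC.sym (push-single ρ x M)) (ax≈ (ρ x) M)
  ren-der ρ (app≈ {Γ = Γ} {Π = Π} d₁ d₂) =
    conv-ctx (TC.sym (push-⊎ ρ Γ Π)) (app≈ (ren-der ρ d₁) (ren-der ρ d₂))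
  ren-der ρ (lam≈ ds) with ren-many ρ ds
  ... | _ , c , ds' = conv-ctx (TC.sym c) (lam≈ ds')
  ren-der ρ (es≈ {Γ = Γ} {Π = Π} d₁ d₂) =
    conv-ctx (TC.sym (push-⊎ ρ Γ Π)) (es≈ (ren-der-lift ρ d₁) (ren-der ρ d₂))
  ren-der ρ (conv d p q) = conv (ren-der ρ d) (push-cong ρ p) q

  ren-many : ∀ {n n'} (ρ : Ren n n') {Γ t M m e} → Many≈ Γ t M m e →
             Σ (TCtx n') λ Γ' → push ρ Γ ≈C Γ' × Many≈ Γ' (ren (lift ρ) t) M m e
  ren-many ρ nil≈ = _ , push-empty ρ , nil≈
  ren-many ρ (cons≈ {Γ = Γ} {Δ = Δ} d ds) with ren-many ρ ds
  ... | _ , c , ds' =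
    _ , TC.trans (push-⊎ ρ Γ Δ) (TC.∙-cong TC.refl c) ,
    cons≈ (ren-der-lift ρ d) ds'

  ren-der-lift : ∀ {n n'} (ρ : Ren n n') {Γ N t M m e} → Der≈ (N ∷ Γ) t M m e →
                 Der≈ (N ∷ push ρ Γ) (ren (lift ρ) t) M m e
  ren-der-lift ρ {Γ} {N} d = conv-ctx (push-lift ρ N Γ) (ren-der (lift ρ) d)

liftN : ∀ {n n'} b → Ren n n' → Ren (b ⊕ n) (b ⊕ n')
liftN zero    ρ = ρ
liftN (suc b) ρ = liftN b (lift ρ)

liftN-wk : ∀ b {n n'} (ρ : Ren n n') x → liftN b ρ (wk b x) ≡ wk b (ρ x)
liftN-wk zero    ρ x = refl
liftN-wk (suc b) ρ x = liftN-wk b (lift ρ) (suc x)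

-- Renaming commutes with plugging into a CbNeed context; in particular
-- renaming E⟨⟨x⟩⟩ renames E and x, which identifies the renamed body of an
-- exponential redex with the body of its reduct.
mutual
  ren-plug : ∀ {n n' b} (ρ : Ren n n') (E : Ctx n b) u →
             ren ρ (plug E u) ≡ plug (renC ρ E) (ren (liftN b ρ) u)
  ren-plug ρ (appL E t) u = cong (λ z → app z (ren ρ t)) (ren-plug ρ E u)
  ren-plug ρ (esL E t)  u = cong (λ z → es z (ren ρ t)) (ren-plug (lift ρ) E u)
  ren-plug ρ (esR E E') u = cong₂ es (ren-plugNC-var (lift ρ) E zero) (ren-plug ρ E' u)
  ren-plug ρ hole       u = refl

  ren-plugNC-var : ∀ {n n' b} (ρ : Ren n n') (E : Ctx n b) x →
                   ren ρ (plugNC E (var x)) ≡ plugNC (renC ρ E) (var (ρ x))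
  ren-plugNC-var {b = b} ρ E x =
    trans (ren-plug ρ E (var (wk b x))) (cong (λ y → plug (renC ρ E) (var y)) (liftN-wk b ρ x))

data Progress {n : ℕ} (t : Tm n) : Set where
  normal  : Normal t → Progress t
  m-redex : ∀ {u} → t ⟶m u → Progress t
  e-redex : ∀ {u} → t ⟶e u → Progress t
  stuck   : ∀ {b} (E : Ctx n b) (x : Fin n) → t ≡ plug E (var (wk b x)) → Progress t

normal-answer : ∀ {n} {t : Tm n} → Normal t →
                Σ ℕ λ b → Σ (SCtx n b) λ S → Σ (Tm (suc (b ⊕ n))) λ t' → t ≡ plugS S (lam t')
normal-answer nLam = 0 , sHole , _ , refl
normal-answer (nES {s = s} nt) with normal-answer nt
... | b , S , t' , refl = suc b , sES S s , t' , refl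

progress : ∀ {n} (t : Tm n) → Progress t
progress (var x) = stuck hole x refl
progress (lam t) = normal nLam
progress (app t s) with progress t
... | normal nt with normal-answer nt
...   | _ , S , t' , refl = m-redex (ctxM hole (rootM S t' s))
progress (app t s) | m-redex (ctxM E r) = m-redex (ctxM (appL E s) r)
progress (app t s) | e-redex (ctxE E r) = e-redex (ctxE (appL E s) r)
progress (app t s) | stuck E x refl     = stuck (appL E s) x refl
progress (es t s) with progress t
... | normal nt           = normal (nES nt)
... | m-redex (ctxM E r)  = m-redex (ctxM (esL E s) r)
... | e-redex (ctxE E r)  = e-redex (ctxE (esL E s) r)
... | stuck E (suc x) refl = stuck (esL E s) x refl
... | stuck E zero refl with progress s
...   | normal ns with normal-answer ns
...     | _ , S , t' , refl = e-redex (ctxE hole (rootE E S t'))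
progress (es t s) | stuck E zero refl | m-redex (ctxM E' r) = m-redex (ctxM (esR E E') r)
progress (es t s) | stuck E zero refl | e-redex (ctxE E' r) = e-redex (ctxE (esR E E') r)
progress (es t s) | stuck E zero refl | stuck E' x refl     = stuck (esR E E') x refl

-- Factorisation along substitution contexts: a derivation for S⟨u⟩ is one for
-- u together with derivations for the substitutions of S, and the latter can
-- be put back around any term typed in u's context extended by outer variables.
record SFactor {n b : ℕ} (S : SCtx n b) (Γ : TCtx n) (u : Tm (b ⊕ n)) (N : MTy) (m e : ℕ) : Set where
  constructor s-factor
  field
    {Δ}           : TCtx (b ⊕ n)
    {mᵤ eᵤ mₛ eₛ} : ℕ
    inner         : Der≈ Δ u N mᵤ eᵤ
    m-eq          : m ≡ mᵤ + mₛ
    e-eq          : e ≡ eᵤ + eₛ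
    reattach      : ∀ Ξ {u' N' m' e'} → Der≈ (Δ ⊎T push (wk b) Ξ) u' N' m' e' →
                    Der≈ (Γ ⊎T Ξ) (plugS S u') N' (m' + mₛ) (e' + eₛ)

factor-sHole : ∀ {n} {Γ : TCtx n} {u N m e} → Der≈ Γ u N m e → SFactor sHole Γ u N m e
factor-sHole {m = m} {e} d =
  s-factor d (sym (+-identityʳ m)) (sym (+-identityʳ e))
    λ Ξ d' → cast-+0 (conv-ctx (TC.∙-cong TC.refl (push-id Ξ)) d')

factor-sES : ∀ {n b} {S : SCtx (suc n) b} {s : Tm n} {Γ Γ₁ Γ₂ u N N₀ m₁ e₁ m₂ e₂} →
             SFactor S (N₀ ∷ Γ₁) u N m₁ e₁ → Der≈ Γ₂ s N₀ m₂ e₂ → Γ ≈C Γ₁ ⊎T Γ₂ →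
             SFactor (sES S s) Γ u N (m₁ + m₂) (e₁ + e₂)
factor-sES {b = b} {Γ₁ = Γ₁} {Γ₂} {N₀ = N₀} {m₂ = m₂} {e₂}
           (s-factor {mᵤ = mᵤ} {eᵤ} {mₛ} {eₛ} dᵤ refl refl reattach) d₂ c =
  s-factor dᵤ (+-assoc mᵤ mₛ m₂) (+-assoc eᵤ eₛ e₂)
    λ Ξ {m' = m'} {e'} d' →
      conv-ctx (TC.trans (TC.xy∙z≈xz∙y Γ₁ Ξ Γ₂) (TC.∙-cong (TC.sym c) TC.refl))
        (cast (+-assoc m' mₛ m₂) (+-assoc e' eₛ e₂)
          (es≈ (conv-ctx (≈M-reflexive (++-identityʳ N₀) ∷ TC.refl)
                  (reattach ([] ∷ Ξ) (conv-ctx (TC.∙-cong TC.refl (TC.sym (push-nil (wk b) Ξ))) d')))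
               d₂))

s-factor-of : ∀ {n b} (S : SCtx n b) {Γ u N m e} → Der≈ Γ (plugS S u) N m e → SFactor S Γ u N m e
s-factor-of sHole     d = factor-sHole d
s-factor-of (sES S s) d with inv-es d
... | _ , split d₁ d₂ c refl refl = factor-sES (s-factor-of S d₁) d₂ c

-- A derivation for E⟨u⟩ is one for u
-- (with some context Δ and type N) and a remainder, so that
--  * u can be replaced by any u' with the same context and type (refill);
--  * if Δ only mentions variables free in E⟨u⟩, say Δ = Δ₀ pushed under the
--    binders of E, then Δ₀ is a summand of Γ and u can be replaced by any u'
--    typed in any such outer context (detach).
record Detached {n b : ℕ} (E : Ctx n b) (Γ Δ₀ : TCtx n) (N M : MTy) (mₑ eₑ : ℕ) : Set where
  constructor detached
  field
    {rest}  : TCtx n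
    ctx-eq  : Γ ≈C rest ⊎T Δ₀
    replace : ∀ Ξ {u' m' e'} → Der≈ (push (wk b) Ξ) u' N m' e' →
              Der≈ (rest ⊎T Ξ) (plug E u') M (m' + mₑ) (e' + eₑ)

record EFactor {n b : ℕ} (E : Ctx n b) (Γ : TCtx n) (u : Tm (b ⊕ n)) (M : MTy) (m e : ℕ) : Set where
  constructor e-factor
  field
    {Δ}           : TCtx (b ⊕ n)
    {N}           : MTy
    {mᵤ eᵤ mₑ eₑ} : ℕ
    inner         : Der≈ Δ u N mᵤ eᵤ
    m-eq          : m ≡ mᵤ + mₑ
    e-eq          : e ≡ eᵤ + eₑ
    refill        : ∀ {u' m' e'} → Der≈ Δ u' N m' e' → Der≈ Γ (plug E u') M (m' + mₑ) (e' + eₑ)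
    detach        : ∀ Δ₀ → Δ ≈C push (wk b) Δ₀ → Detached E Γ Δ₀ N M mₑ eₑ

factor-hole : ∀ {n} {Γ : TCtx n} {u M m e} → Der≈ Γ u M m e → EFactor hole Γ u M m e
factor-hole {m = m} {e} d =
  e-factor d (sym (+-identityʳ m)) (sym (+-identityʳ e)) cast-+0
    λ Δ₀ c → detached (TC.trans c (TC.trans (push-id Δ₀) (TC.sym (TC.identityˡ Δ₀))))
               λ Ξ d' → cast-+0 (conv-ctx (TC.trans (push-id Ξ) (TC.sym (TC.identityˡ Ξ))) d')

+-assoc-+1 : ∀ a b c → a + b + c + 1 ≡ a + (b + c + 1)
+-assoc-+1 a b c = trans (cong (_+ 1) (+-assoc a b c)) (+-assoc a (b + c) 1)

detached-appL : ∀ {n b} {E : Ctx n b} {s : Tm n} {Γ Γ₁ Γ₂ Δ₀ N A M mₑ eₑ m₂ e₂} →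
                Detached E Γ₁ Δ₀ N ((A ⇒ M) ∷ []) mₑ eₑ → Der≈ Γ₂ s A m₂ e₂ →
                Γ ≈C Γ₁ ⊎T Γ₂ → Detached (appL E s) Γ Δ₀ N M (mₑ + m₂ + 1) (eₑ + e₂)
detached-appL {Γ₂ = Γ₂} {Δ₀} {mₑ = mₑ} {eₑ} {m₂} {e₂} (detached {rest} c' replace) d₂ c =
  detached (TC.trans c (TC.trans (TC.∙-cong c' TC.refl) (TC.xy∙z≈xz∙y rest Δ₀ Γ₂)))
    λ Ξ {m' = m'} {e'} d' →
      conv-ctx (TC.xy∙z≈xz∙y rest Ξ Γ₂)
        (cast (+-assoc-+1 m' mₑ m₂) (+-assoc e' eₑ e₂) (app≈ (replace Ξ d') d₂))

-- the variable bound by esL does not occur in the detached context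
detached-esL : ∀ {n b} {E : Ctx (suc n) b} {s : Tm n} {Γ Γ₁ Γ₂ Δ₀ N N' M mₑ eₑ m₂ e₂} →
               Detached E (N ∷ Γ₁) ([] ∷ Δ₀) N' M mₑ eₑ → Der≈ Γ₂ s N m₂ e₂ →
               Γ ≈C Γ₁ ⊎T Γ₂ → Detached (esL E s) Γ Δ₀ N' M (mₑ + m₂) (eₑ + e₂)
detached-esL {b = b} {Γ₂ = Γ₂} {Δ₀} {mₑ = mₑ} {eₑ} {m₂} {e₂}
             (detached {_ ∷ rest} (p ∷ c') replace) d₂ c =
  detached (TC.trans c (TC.trans (TC.∙-cong c' TC.refl) (TC.xy∙z≈xz∙y rest Δ₀ Γ₂)))
    λ Ξ {m' = m'} {e'} d' →
      conv-ctx (TC.xy∙z≈xz∙y rest Ξ Γ₂)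
        (cast (+-assoc m' mₑ m₂) (+-assoc e' eₑ e₂)
          (es≈ (conv-ctx (≈M-sym p ∷ TC.refl)
                  (replace ([] ∷ Ξ) (conv-ctx (TC.sym (push-nil (wk b) Ξ)) d')))
               d₂))

detached-esR : ∀ {n b b'} {E : Ctx (suc n) b} {E' : Ctx n b'} {Γ Γ₁ Γ₂ Δ₀ N N' M m₁ e₁ mₑ eₑ} →
               Der≈ (N ∷ Γ₁) (plugNC E (var zero)) M m₁ e₁ → Detached E' Γ₂ Δ₀ N' N mₑ eₑ →
               Γ ≈C Γ₁ ⊎T Γ₂ → Detached (esR E E') Γ Δ₀ N' M (m₁ + mₑ) (e₁ + eₑ)
detached-esR {Γ₁ = Γ₁} {Δ₀ = Δ₀} {m₁ = m₁} {e₁} {mₑ} {eₑ} d₁ (detached {rest} c' replace) c =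
  detached (TC.trans c (TC.trans (TC.∙-cong TC.refl c') (TC.sym (TC.assoc Γ₁ rest Δ₀))))
    λ Ξ {m' = m'} {e'} d' →
      conv-ctx (TC.sym (TC.assoc Γ₁ rest Ξ))
        (cast (ℕₚ.x∙yz≈y∙xz m₁ m' mₑ) (ℕₚ.x∙yz≈y∙xz e₁ e' eₑ) (es≈ d₁ (replace Ξ d')))

factor-appL : ∀ {n b} {E : Ctx n b} {s : Tm n} {Γ Γ₁ Γ₂ u A M m₁ e₁ m₂ e₂} →
              EFactor E Γ₁ u ((A ⇒ M) ∷ []) m₁ e₁ → Der≈ Γ₂ s A m₂ e₂ → Γ ≈C Γ₁ ⊎T Γ₂ →
              EFactor (appL E s) Γ u M (m₁ + m₂ + 1) (e₁ + e₂)
factor-appL {m₂ = m₂} {e₂} (e-factor {mᵤ = mᵤ} {eᵤ} {mₑ} {eₑ} dᵤ refl refl refill detach) d₂ c =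
  e-factor dᵤ (+-assoc-+1 mᵤ mₑ m₂) (+-assoc eᵤ eₑ e₂)
    (λ {m' = m'} {e'} d' →
       conv-ctx (TC.sym c) (cast (+-assoc-+1 m' mₑ m₂) (+-assoc e' eₑ e₂) (app≈ (refill d') d₂)))
    (λ Δ₀ cΔ → detached-appL (detach Δ₀ cΔ) d₂ c)

factor-esL : ∀ {n b} {E : Ctx (suc n) b} {s : Tm n} {Γ Γ₁ Γ₂ u M N m₁ e₁ m₂ e₂} →
             EFactor E (N ∷ Γ₁) u M m₁ e₁ → Der≈ Γ₂ s N m₂ e₂ → Γ ≈C Γ₁ ⊎T Γ₂ →
             EFactor (esL E s) Γ u M (m₁ + m₂) (e₁ + e₂)
factor-esL {b = b} {m₂ = m₂} {e₂} (e-factor {mᵤ = mᵤ} {eᵤ} {mₑ} {eₑ} dᵤ refl refl refill detach) d₂ c =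
  e-factor dᵤ (+-assoc mᵤ mₑ m₂) (+-assoc eᵤ eₑ e₂)
    (λ {m' = m'} {e'} d' →
       conv-ctx (TC.sym c) (cast (+-assoc m' mₑ m₂) (+-assoc e' eₑ e₂) (es≈ (refill d') d₂)))
    (λ Δ₀ cΔ → detached-esL (detach ([] ∷ Δ₀) (TC.trans cΔ (TC.sym (push-nil (wk b) Δ₀)))) d₂ c)

factor-esR : ∀ {n b b'} {E : Ctx (suc n) b} {E' : Ctx n b'} {Γ Γ₁ Γ₂ u M N m₁ e₁ m₂ e₂} →
             Der≈ (N ∷ Γ₁) (plugNC E (var zero)) M m₁ e₁ → EFactor E' Γ₂ u N m₂ e₂ →
             Γ ≈C Γ₁ ⊎T Γ₂ → EFactor (esR E E') Γ u M (m₁ + m₂) (e₁ + e₂)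
factor-esR {m₁ = m₁} {e₁} d₁ (e-factor {mᵤ = mᵤ} {eᵤ} {mₑ} {eₑ} dᵤ refl refl refill detach) c =
  e-factor dᵤ (ℕₚ.x∙yz≈y∙xz m₁ mᵤ mₑ) (ℕₚ.x∙yz≈y∙xz e₁ eᵤ eₑ)
    (λ {m' = m'} {e'} d' →
       conv-ctx (TC.sym c)
         (cast (ℕₚ.x∙yz≈y∙xz m₁ m' mₑ) (ℕₚ.x∙yz≈y∙xz e₁ e' eₑ) (es≈ d₁ (refill d'))))
    (λ Δ₀ cΔ → detached-esR d₁ (detach Δ₀ cΔ) c)

e-factor-of : ∀ {n b} (E : Ctx n b) {Γ u M m e} → Der≈ Γ (plug E u) M m e → EFactor E Γ u M m e
e-factor-of hole d = factor-hole d
e-factor-of (appL E s) d with inv-app d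
... | _ , _ , refl , split d₁ d₂ c refl refl = factor-appL (e-factor-of E d₁) d₂ c
e-factor-of (esL E s) d with inv-es d
... | _ , split d₁ d₂ c refl refl = factor-esL (e-factor-of E d₁) d₂ c
e-factor-of (esR E E') d with inv-es d
... | _ , split d₁ d₂ c refl refl = factor-esR d₁ (e-factor-of E' d₂) c

-- A multiplicative root step consumes exactly one unit of m: the abstraction
-- under S is typed by the single arrow required by the application, and the
-- argument's derivation is weakened under S to type the new substitution.
sr-root-m : ∀ {n} {Γ : TCtx n} {t u M m e} → t ↦m u → Der≈ Γ t M m e →
            Σ ℕ λ m' → m ≡ suc m' × Der≈ Γ u M m' e
sr-root-m (rootM {b} S t s) d with inv-app d
... | _ , _ , refl , split {Γ₂ = Γ₂} {m₂ = m₂} {e₂ = e₂} d₁ d₂ c refl refl with s-factor-of S d₁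
...   | s-factor {mᵤ = mᵤ} {eᵤ} {mₛ} {eₛ} dλ refl refl reattach =
  mᵤ + m₂ + mₛ , trans (+-comm (mᵤ + mₛ + m₂) 1) (cong suc (ℕₚ.xy∙z≈xz∙y mᵤ mₛ m₂)) ,
  conv-ctx (TC.sym c)
    (cast refl (ℕₚ.xy∙z≈xz∙y eᵤ e₂ eₛ)
      (reattach Γ₂ (es≈ (inv-fun dλ) (ren-der (wk b) d₂))))

-- In E⟨⟨x⟩⟩[x←λy.t], the type N of λy.t splits as Nr ++ Nx, where Nx types
-- the occurrence of x; a copy of λy.t typed Nx replaces x, and the rest of
-- the derivation of λy.t, typed Nr, stays in the substitution.
sr-value : ∀ {n b} {E : Ctx (suc n) b} {t : Tm (suc n)} {Γ Δ N M m₁ e₁ m₂ e₂} →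
           Der≈ (N ∷ Γ) (plugNC E (var zero)) M m₁ e₁ → Der≈ Δ (lam t) N m₂ e₂ →
           Σ ℕ λ e' → e₁ + e₂ ≡ suc e' ×
           Der≈ (Γ ⊎T Δ) (es (plugNC E (ren suc (lam t))) (lam t)) M (m₁ + m₂) e'
sr-value {b = b} {E} d₁ d₂ with e-factor-of E d₁
... | e-factor {N = Nx} {mₑ = mₑ} {eₑ} dx refl refl _ detach with inv-var dx
...   | cx , refl , refl
      with detach (single zero Nx) (TC.trans cx (TC.sym (push-single (wk b) zero Nx)))
...     | detached {Nr ∷ rest} (p ∷ c') replace with inv-lam d₂
...       | _ , cv , ds with many-perm ds p
...         | _ , cv' , ds' with many-split Nr Nx ds'
...           | split {Γa} {Γb} {ma} {ea} {mb} {eb} dsr dsx cab refl refl =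
  eₑ + (ea + eb) , refl ,
  conv-ctx (TC.trans (TC.xy∙z≈x∙zy rest Γb Γa)
                     (TC.∙-cong (TC.sym (TC.trans c' (TC.identityʳ rest)))
                                (TC.sym (TC.trans cv (TC.trans cv' cab)))))
    (cast (ℕₚ.xy∙z≈y∙zx mb mₑ ma) (ℕₚ.xy∙z≈y∙zx eb eₑ ea)
      (es≈ (conv-ctx (TC.trans (TC.∙-cong TC.refl (push-weaken Γb))
                               (≈M-reflexive (++-identityʳ Nr) ∷ TC.refl))
              (replace (push suc Γb) (ren-der (wk b) (ren-der suc (lam≈ dsx)))))
           (lam≈ dsr)))

-- An exponential root step consumes exactly one unit of e: the body is renamed
-- under the substitutions of S, sr-value is applied there, and S is put back.
sr-root-e : ∀ {n} {Γ : TCtx n} {t u M m e} → t ↦e u → Der≈ Γ t M m e →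
            Σ ℕ λ e' → e ≡ suc e' × Der≈ Γ u M m e'
sr-root-e (rootE {bS = bS} E S t) d with inv-es d
... | _ , split {Γ₁} {Γ₂} {m₁} {e₁} d₁ d₂ c refl refl with s-factor-of S d₂
...   | s-factor {Δ = Δv} {mᵤ} {eᵤ} {mₛ} {eₛ} dv refl refl reattach
      with sr-value (subst (λ z → Der≈ _ z _ m₁ e₁) (ren-plugNC-var (lift (wk bS)) E zero)
                             (ren-der-lift (wk bS) d₁))
                      dv
...     | e' , e-eq , d' =
  e' + eₛ , trans (sym (+-assoc e₁ eᵤ eₛ)) (cong (_+ eₛ) e-eq) ,
  conv-ctx (TC.trans (TC.comm Γ₂ Γ₁) (TC.sym c))
    (cast (+-assoc m₁ mᵤ mₛ) refl
      (reattach Γ₁ (conv-ctx (TC.comm (push (wk bS) Γ₁) Δv) d')))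

sr-m : ∀ {n} {Γ : TCtx n} {t u M m e} → t ⟶m u → Der≈ Γ t M m e →
       Σ ℕ λ m' → m ≡ suc m' × Der≈ Γ u M m' e
sr-m (ctxM E r) d with e-factor-of E d
... | e-factor dᵤ refl refl refill _ with sr-root-m r dᵤ
...   | _ , refl , dᵤ' = _ , refl , refill dᵤ'

sr-e : ∀ {n} {Γ : TCtx n} {t u M m e} → t ⟶e u → Der≈ Γ t M m e →
       Σ ℕ λ e' → e ≡ suc e' × Der≈ Γ u M m e'
sr-e (ctxE E r) d with e-factor-of E d
... | e-factor dᵤ refl refl refill _ with sr-root-e r dᵤ
...   | _ , refl , dᵤ' = _ , refl , refill dᵤ'

Normalises : Tm 0 → ℕ → ℕ → Set
Normalises t m e = Σ (Tm 0) λ s → Σ (t ⟶* s) λ d → Normal s × lenM d ≤ m × lenE d ≤ e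

step-m : ∀ {t u m e} → t ⟶m u → Normalises u m e → Normalises t (suc m) e
step-m r (s , d , ns , ≤m , ≤e) = s , stepM r d , ns , s≤s ≤m , ≤e

step-e : ∀ {t u m e} → t ⟶e u → Normalises u m e → Normalises t m (suc e)
step-e r (s , d , ns , ≤m , ≤e) = s , stepE r d , ns , ≤m , s≤s ≤e

-- every derivation of a closed term yields an evaluation to a normal form
-- within its costs; the recursive calls decrease (m, e) lexicographically
normalise : ∀ {t M} m e → Der≈ [] t M m e → Normalises t m e
normalise {t} m e d with progress t
... | normal nt   = t , done , nt , z≤n , z≤n
... | stuck _ () _
... | m-redex r with sr-m r d
...   | m' , refl , d' = step-m r (normalise m' e d')
normalise m e d | e-redex r with sr-e r d
...   | e' , refl , d' = step-e r (normalise m e' d')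

corollary1 : (t : Tm 0) (M : MTy) (m e : ℕ) → Der [] t M m e →
    Σ (Tm 0) (λ s → Σ (t ⟶* s) (λ d → Normal s × lenM d ≤ m × lenE d ≤ e))
corollary1 t M m e d = normalise m e (embed d)
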